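{- Let $d$ be a square-free positive integer, $E=\mathbb{Q}(\sqrt{ -d})$, $\mathcal{O}$ its ring of integers, and let $p$ be a prime number that splits in $E$, with $\mathfrak{P}_1,\mathfrak{P}_2$ prime ideals of $\mathcal{O}$ lying above $p$. For $j=1,2$ and each positive integer $r$, let $\mathfrak{P}_jv_j^{r}$ denote the unary Hermitian lattice $\mathfrak{P}_jv_j$ in a one-dimensional Hermitian space $Ev_j$ with $h(v_j)=r/p$. Then for every positive integer $r$ and every positive integer $m$, $\mathfrak{P}_1v_1^{r}$ is represented by $I_m$ if and only if $\mathfrak{P}_2v_2^{r}$ is represented by $I_m$; in particular, the set of positive integers $r$ with $\mathfrak{P}_1v_1^{r}\in\mathfrak{S}_d(1)$ equals the set of positive integers $r$ with $\mathfrak{P}_2v_2^{r}\in\mathfrak{S}_d(1)$.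
   Context: A Hermitian space $(V,h)$ is a finite-dimensional $E$-vector space with a map $h:V\times V\to E$ that is $E$-linear in the first variable and satisfies $h(v,w)=\overline{h(w,v)}$; write $h(v)=h(v,v)$. A Hermitian lattice is a finitely generated $\mathcal{O}$-submodule of a Hermitian space; it is positive definite integral if $h(v)\in\mathbb{Z}_{>0}$ for all nonzero $v$ and $h(v,w)\in\mathcal{O}$ for all $v,w$ in it (the lattices $\mathfrak{P}_jv_j^r$ are positive definite integral since $\mathfrak{P}_j\overline{\mathfrak{P}_j}=p\mathcal{O}$). A lattice $L$ is represented by $K$ if there is an injective $\mathcal{O}$-linear map $L\to K$ preserving $h$. $I_m$ is the free Hermitian lattice $\mathcal{O}w_1+\cdots+\mathcal{O}w_m$ with $h(w_i,w_k)=\delta_{ik}$. $\mathfrak{S}_d(1)$ is the set of all positive definite integral unary Hermitian lattices over $\mathcal{O}$ represented by $I_m$ for some positive integer $m$. -}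

module Defs where

open import Data.Nat as ℕ using (ℕ; _%_; _/_; _≡ᵇ_)
open import Data.Nat.Divisibility using (_∣_)
open import Data.Integer as ℤ using (ℤ; +_)
open import Data.Bool using (if_then_else_)
open import Data.Product using (Σ; ∃; _×_; _,_; proj₁; proj₂)
open import Data.Sum using (_⊎_)
open import Data.List using (List; []; _∷_)
open import Data.List.Relation.Unary.All using (All)
open import Data.Vec using (Vec; []; _∷_; zipWith; map; foldr)
open import Relation.Binary.PropositionalEquality using (_≡_)
open import Relation.Nullary using (¬_)

SquareFree : ℕ → Set
SquareFree d = (k : ℕ) → (k ℕ.* k) ∣ d → k ≡ 1

-- Elements  re + im·ω  of the ring of integers 𝒪 = ℤ[ω] of ℚ(√-d),
-- where ω = √-d if d ≢ 3 (mod 4) and ω = (1+√-d)/2 if d ≡ 3 (mod 4).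
record 𝒪 : Set where
  constructor mk
  field
    re : ℤ
    im : ℤ

module QF (d : ℕ) where

  -- ω² = t·ω − n
  t : ℤ
  t = if (d % 4) ≡ᵇ 3 then + 1 else + 0

  n : ℤ
  n = if (d % 4) ≡ᵇ 3 then + ((d ℕ.+ 1) / 4) else + d

  infixl 6 _+ᴼ_
  infixl 7 _*ᴼ_

  _+ᴼ_ : 𝒪 → 𝒪 → 𝒪
  mk a b +ᴼ mk c e = mk (a ℤ.+ c) (b ℤ.+ e)

  _*ᴼ_ : 𝒪 → 𝒪 → 𝒪
  mk a b *ᴼ mk c e =
    mk (a ℤ.* c ℤ.- n ℤ.* (b ℤ.* e)) (a ℤ.* e ℤ.+ b ℤ.* c ℤ.+ t ℤ.* (b ℤ.* e))

  -- complex conjugation (the nontrivial automorphism of E): ω̄ = t − ω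
  conj : 𝒪 → 𝒪
  conj (mk a b) = mk (a ℤ.+ t ℤ.* b) (ℤ.- b)

  0ᴼ 1ᴼ : 𝒪
  0ᴼ = mk (+ 0) (+ 0)
  1ᴼ = mk (+ 1) (+ 0)

  ι : ℕ → 𝒪
  ι k = mk (+ k) (+ 0)

  record IsIdeal (I : 𝒪 → Set) : Set where
    field
      has-0  : I 0ᴼ
      has-+  : ∀ x y → I x → I y → I (x +ᴼ y)
      has-*  : ∀ a x → I x → I (a *ᴼ x)

  record IsPrimeIdeal (I : 𝒪 → Set) : Set where
    field
      isIdeal : IsIdeal I
      proper  : ¬ I 1ᴼ
      prime   : ∀ a b → I (a *ᴼ b) → I a ⊎ I b

  _≐_ : (I J : 𝒪 → Set) → Set
  I ≐ J = ∀ x → (I x → J x) × (J x → I x)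

  sumᴸ : List (𝒪 × 𝒪) → 𝒪
  sumᴸ [] = 0ᴼ
  sumᴸ ((a , b) ∷ l) = a *ᴼ b +ᴼ sumᴸ l

  _·_ : (I J : 𝒪 → Set) → 𝒪 → Set
  (I · J) x = Σ (List (𝒪 × 𝒪)) λ l →
    All (λ ab → I (proj₁ ab) × J (proj₂ ab)) l × x ≡ sumᴸ l

  ⟨_⟩ : 𝒪 → 𝒪 → Set
  ⟨ a ⟩ x = Σ 𝒪 λ c → x ≡ c *ᴼ a

  Splits : ℕ → Set₁
  Splits p = Σ (𝒪 → Set) λ P → Σ (𝒪 → Set) λ Q →
    IsPrimeIdeal P × IsPrimeIdeal Q × ¬ (P ≐ Q) × (⟨ ι p ⟩ ≐ (P · Q))

  LiesAbove : (𝒪 → Set) → ℕ → Set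
  LiesAbove P p = P (ι p)

  -- The free Hermitian lattice I_m = 𝒪^m with h(u,w) = Σ uᵢ w̄ᵢ

  sumⱽ : ∀ {m} → Vec 𝒪 m → 𝒪
  sumⱽ = foldr _ _+ᴼ_ 0ᴼ

  hI : ∀ {m} → Vec 𝒪 m → Vec 𝒪 m → 𝒪
  hI u w = sumⱽ (zipWith (λ a b → a *ᴼ conj b) u w)

  _+ⱽ_ : ∀ {m} → Vec 𝒪 m → Vec 𝒪 m → Vec 𝒪 m
  _+ⱽ_ = zipWith _+ᴼ_

  _·ⱽ_ : ∀ {m} → 𝒪 → Vec 𝒪 m → Vec 𝒪 m
  a ·ⱽ u = map (a *ᴼ_) u

  -- The unary lattice 𝔓v^r = 𝔓·v in Ev with h(v) = r/p.
  -- Its elements are x·v with x ∈ 𝔓, and h(xv, yv) = (r/p)·x·ȳ.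

  -- 𝔓v^r is represented by I_m: an injective 𝒪-linear map
  -- f : 𝔓v → I_m with h(f(xv), f(yv)) = (r/p) x ȳ  (multiplied by p).
  Represented : (𝒪 → Set) → (p r m : ℕ) → Set
  Represented P p r m =
    Σ ((x : 𝒪) → P x → Vec 𝒪 m) λ f →
      (∀ x y (px : P x) (py : P y) (pxy : P (x +ᴼ y)) →
         f (x +ᴼ y) pxy ≡ f x px +ⱽ f y py) ×
      (∀ a x (px : P x) (pax : P (a *ᴼ x)) → f (a *ᴼ x) pax ≡ a ·ⱽ f x px) ×
      (∀ x y (px : P x) (py : P y) → f x px ≡ f y py → x ≡ y) ×
      (∀ x y (px : P x) (py : P y) →
         ι p *ᴼ hI (f x px) (f y py) ≡ ι r *ᴼ (x *ᴼ conj y))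

  PosDefIntegral : (𝒪 → Set) → (p r : ℕ) → Set
  PosDefIntegral P p r =
    (∀ x y → P x → P y → Σ 𝒪 λ z → ι p *ᴼ z ≡ ι r *ᴼ (x *ᴼ conj y)) ×
    (∀ x → P x → ¬ (x ≡ 0ᴼ) →
       Σ ℕ λ k → (1 ℕ.≤ k) × (ι p *ᴼ ι k ≡ ι r *ᴼ (x *ᴼ conj x)))

  InS : (𝒪 → Set) → (p r : ℕ) → Set
  InS P p r = PosDefIntegral P p r × Σ ℕ λ m → (1 ℕ.≤ m) × Represented P p r m

-- Complex conjugation interchanges the two primes above p: for y ∈ 𝔓₂ the norm y·ȳ lies in
-- 𝔓₂ ∩ ℤ = pℤ ⊆ 𝔓₁, so y or ȳ lies in 𝔓₁; then ȳ = trace y − y ∈ 𝔓₁, since an element of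
-- 𝔓₁ ∩ 𝔓₂ whose trace is prime to p would force 𝔓₁ = 𝔓₂.  Conjugating a representation f of
-- 𝔓₁v^r by I_m on both sides, x ↦ conj (f (conj x)), therefore gives an 𝒪-linear injective map
-- on 𝔓₂v^r whose Hermitian values (r/p)·conj(x̄·y) = (r/p)·x·ȳ are those of 𝔓₂v^r.  Integrality
-- and positivity transfer in the same way.

module Submission where

open import Defs
open import Data.Nat using (ℕ; _≤_)
open import Data.Nat.Primality using (Prime)
open import Data.Product using (_×_)
open import Function.Bundles using (_⇔_)
open import Relation.Nullary using (¬_)

import Data.Nat as ℕ
open import Data.Nat.Divisibility using () renaming (_∣_ to _∣ℕ_; _∣?_ to _∣ℕ?_)
open import Data.Nat.GCD using (module GCD; module Bézout)
open import Data.Nat.Primality using (prime⇒irreducible)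
open import Data.Integer using (ℤ; +_; -[1+_]; -1ℤ; _+_; _*_; _-_; -_; ∣_∣)
import Data.Integer.Properties as ℤ
open import Data.Integer.Divisibility.Signed
  using (_∣_; _∣?_; divides; ∣ᵤ⇒∣; ∣m∣n⇒∣m+n; ∣n⇒∣m*n)
open import Data.Integer.Tactic.RingSolver using (solve-∀)
open import Algebra.Properties.AbelianGroup ℤ.+-0-abelianGroup using (∙-cancelʳ)
open import Data.Vec using (Vec; []; _∷_; map)
open import Data.Vec.Properties using (∷-injective; map-∘; map-cong; map-id)
open import Data.Product using (Σ; _,_; proj₁; proj₂; swap)
open import Data.Sum using (inj₁; inj₂; [_,_]′)
open import Function using (id; _∘_)
open import Relation.Binary.PropositionalEquality
open import Relation.Nullary using (yes; no; contradiction)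
open import Function.Bundles using (mk⇔)

prime-Bézout : ∀ {p m} → Prime p → ¬ (p ∣ℕ m) → Bézout.Identity 1 m p
prime-Bézout {p} {m} p-prime p∤m with Bézout.lemma m p
... | Bézout.result _ g bézout with prime⇒irreducible p-prime (GCD.gcd∣n g)
...   | inj₁ refl = bézout
...   | inj₂ refl = contradiction (GCD.gcd∣m g) p∤m

module Quadratic (d : ℕ) where
  open QF d

  fromℤ : ℤ → 𝒪
  fromℤ k = mk k (+ 0)

  ω : 𝒪
  ω = mk (+ 0) (+ 1)

  infixl 6 _-ᴼ_
  _-ᴼ_ : 𝒪 → 𝒪 → 𝒪
  x -ᴼ y = x +ᴼ fromℤ -1ℤ *ᴼ y

  trace norm : 𝒪 → ℤ
  trace x = 𝒪.re x + 𝒪.re x + t * 𝒪.im x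
  norm x = 𝒪.re x * 𝒪.re x + t * (𝒪.re x * 𝒪.im x) + n * (𝒪.im x * 𝒪.im x)

  cross : 𝒪 → 𝒪 → ℤ
  cross y x = 𝒪.im y * 𝒪.re x - 𝒪.im x * 𝒪.re y

  -- Each identity in 𝒪 below is checked coordinatewise in the basis 1, ω,
  -- as a polynomial identity in which t and n are indeterminates.

  *ᴼ-comm : ∀ x y → x *ᴼ y ≡ y *ᴼ x
  *ᴼ-comm (mk a b) (mk c e) = cong₂ mk (re-part a b c e n) (im-part a b c e t)
    where
    re-part : ∀ a b c e n → a * c - n * (b * e) ≡ c * a - n * (e * b)
    re-part = solve-∀
    im-part : ∀ a b c e t → a * e + b * c + t * (b * e) ≡ c * b + e * a + t * (e * b)
    im-part = solve-∀

  +ᴼ-cancelʳ : ∀ {x y z} → x +ᴼ z ≡ y +ᴼ z → x ≡ y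
  +ᴼ-cancelʳ {mk a b} {mk a' b'} {mk c e} eq =
    cong₂ mk (∙-cancelʳ c a a' (cong 𝒪.re eq)) (∙-cancelʳ e b b' (cong 𝒪.im eq))

  fromℤ-* : ∀ u v → fromℤ u *ᴼ fromℤ v ≡ fromℤ (u * v)
  fromℤ-* u v = cong₂ mk (re-part u v n) (im-part u v t)
    where
    re-part : ∀ u v n → u * v - n * (+ 0 * + 0) ≡ u * v
    re-part = solve-∀
    im-part : ∀ u v t → u * + 0 + + 0 * v + t * (+ 0 * + 0) ≡ + 0
    im-part = solve-∀

  ι-* : ∀ a b → ι a *ᴼ ι b ≡ ι (a ℕ.* b)
  ι-* a b = trans (fromℤ-* (+ a) (+ b)) (cong fromℤ (sym (ℤ.pos-* a b)))

  ι-suc-ι : ∀ u → ι (ℕ.suc u) -ᴼ ι u ≡ 1ᴼ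
  ι-suc-ι u = trans (cong (ι (ℕ.suc u) +ᴼ_) (fromℤ-* -1ℤ (+ u))) (cong fromℤ (re-part (+ u)))
    where
    re-part : ∀ k → + 1 + k + -1ℤ * k ≡ + 1
    re-part = solve-∀

  conj-+ : ∀ x y → conj (x +ᴼ y) ≡ conj x +ᴼ conj y
  conj-+ (mk a b) (mk c e) = cong₂ mk (re-part a b c e t) (ℤ.neg-distrib-+ b e)
    where
    re-part : ∀ a b c e t → a + c + t * (b + e) ≡ (a + t * b) + (c + t * e)
    re-part = solve-∀

  conj-* : ∀ x y → conj (x *ᴼ y) ≡ conj x *ᴼ conj y
  conj-* (mk a b) (mk c e) = cong₂ mk (re-part a b c e t n) (im-part a b c e t)
    where
    re-part : ∀ a b c e t n → a * c - n * (b * e) + t * (a * e + b * c + t * (b * e))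
                            ≡ (a + t * b) * (c + t * e) - n * ((- b) * (- e))
    re-part = solve-∀
    im-part : ∀ a b c e t → - (a * e + b * c + t * (b * e))
                          ≡ (a + t * b) * (- e) + (- b) * (c + t * e) + t * ((- b) * (- e))
    im-part = solve-∀

  conj-involutive : ∀ x → conj (conj x) ≡ x
  conj-involutive (mk a b) = cong₂ mk (re-part a b t) (ℤ.neg-involutive b)
    where
    re-part : ∀ a b t → a + t * b + t * (- b) ≡ a
    re-part = solve-∀

  conj-fromℤ : ∀ k → conj (fromℤ k) ≡ fromℤ k
  conj-fromℤ k = cong fromℤ (trans (cong (λ z → k + z) (ℤ.*-zeroʳ t)) (ℤ.+-identityʳ k))

  conj-as-trace : ∀ x → conj x ≡ fromℤ (trace x) -ᴼ x
  conj-as-trace (mk a b) = cong₂ mk (re-part a b t n) (im-part a b t)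
    where
    re-part : ∀ a b t n → a + t * b ≡ a + a + t * b + (-1ℤ * a - n * (+ 0 * b))
    re-part = solve-∀
    im-part : ∀ a b t → - b ≡ + 0 + (-1ℤ * b + + 0 * a + t * (+ 0 * b))
    im-part = solve-∀

  *-conj-norm : ∀ x → x *ᴼ conj x ≡ fromℤ (norm x)
  *-conj-norm (mk a b) = cong₂ mk (re-part a b t n) (im-part a b t)
    where
    re-part : ∀ a b t n → a * (a + t * b) - n * (b * - b) ≡ a * a + t * (a * b) + n * (b * b)
    re-part = solve-∀
    im-part : ∀ a b t → a * - b + b * (a + t * b) + t * (b * - b) ≡ + 0
    im-part = solve-∀

  re-as-difference : ∀ x → fromℤ (𝒪.re x) ≡ x -ᴼ ω *ᴼ fromℤ (𝒪.im x)
  re-as-difference (mk a b) = cong₂ mk (re-part a b t n) (im-part a b t n)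
    where
    re-part : ∀ a b t n →
      a ≡ a + (-1ℤ * (+ 0 * b - n * (+ 1 * + 0)) - n * (+ 0 * (+ 0 * + 0 + + 1 * b + t * (+ 1 * + 0))))
    re-part = solve-∀
    im-part : ∀ a b t n →
      + 0 ≡ b + (-1ℤ * (+ 0 * + 0 + + 1 * b + t * (+ 1 * + 0))
                 + + 0 * (+ 0 * b - n * (+ 1 * + 0)) + t * (+ 0 * (+ 0 * + 0 + + 1 * b + t * (+ 1 * + 0))))
    im-part = solve-∀

  cross-as-difference : ∀ y x → fromℤ (cross y x) ≡ fromℤ (𝒪.im y) *ᴼ x -ᴼ fromℤ (𝒪.im x) *ᴼ y
  cross-as-difference (mk a b) (mk c e) = cong₂ mk (re-part a b c e t n) (im-part a b c e t n)
    where
    re-part : ∀ a b c e t n → b * c - e * a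
      ≡ b * c - n * (+ 0 * e) + (-1ℤ * (e * a - n * (+ 0 * b)) - n * (+ 0 * (e * b + + 0 * a + t * (+ 0 * b))))
    re-part = solve-∀
    im-part : ∀ a b c e t n → + 0
      ≡ b * e + + 0 * c + t * (+ 0 * e)
        + (-1ℤ * (e * b + + 0 * a + t * (+ 0 * b)) + + 0 * (e * a - n * (+ 0 * b))
           + t * (+ 0 * (e * b + + 0 * a + t * (+ 0 * b))))
    im-part = solve-∀

  cross-decomposition : ∀ y x → fromℤ (𝒪.im y) *ᴼ x ≡ fromℤ (𝒪.im x) *ᴼ y +ᴼ fromℤ (cross y x)
  cross-decomposition (mk a b) (mk c e) = cong₂ mk (re-part a b c e n) (im-part a b c e t)
    where
    re-part : ∀ a b c e n → b * c - n * (+ 0 * e) ≡ e * a - n * (+ 0 * b) + (b * c - e * a)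
    re-part = solve-∀
    im-part : ∀ a b c e t → b * e + + 0 * c + t * (+ 0 * e) ≡ e * b + + 0 * a + t * (+ 0 * b) + + 0
    im-part = solve-∀

  module _ {I : 𝒪 → Set} (I-ideal : IsIdeal I) where
    open IsIdeal I-ideal

    has-difference : ∀ {x y} → I x → I y → I (x -ᴼ y)
    has-difference {x} {y} Ix Iy = has-+ x _ Ix (has-* (fromℤ -1ℤ) y Iy)

    has-ι-multiple : ∀ k {m} → I (ι m) → I (ι (k ℕ.* m))
    has-ι-multiple k {m} Im = subst I (ι-* k m) (has-* (ι k) (ι m) Im)

    has-1-of-consecutive : ∀ {u} → I (ι (ℕ.suc u)) → I (ι u) → I 1ᴼ
    has-1-of-consecutive {u} Isu Iu = subst I (ι-suc-ι u) (has-difference Isu Iu)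

    has-1-of-coprime : ∀ {p m} → Prime p → I (ι p) → I (ι m) → ¬ (p ∣ℕ m) → I 1ᴼ
    has-1-of-coprime p-prime Ip Im p∤m with prime-Bézout p-prime p∤m
    ... | Bézout.+- x y 1+yp≡xm =
      has-1-of-consecutive (subst (I ∘ ι) (sym 1+yp≡xm) (has-ι-multiple x Im)) (has-ι-multiple y Ip)
    ... | Bézout.-+ x y 1+xm≡yp =
      has-1-of-consecutive (subst (I ∘ ι) (sym 1+xm≡yp) (has-ι-multiple y Ip)) (has-ι-multiple x Im)

    has-ι-∣∣ : ∀ k → I (fromℤ k) → I (ι ∣ k ∣)
    has-ι-∣∣ (+ m) Ik = Ik
    has-ι-∣∣ k@(-[1+ m ]) Ik =
      subst I (trans (fromℤ-* -1ℤ k) (cong fromℤ (ℤ.-1*i≡-i k))) (has-* (fromℤ -1ℤ) (fromℤ k) Ik)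

    ∣⇒has-fromℤ : ∀ {p k} → I (ι p) → + p ∣ k → I (fromℤ k)
    ∣⇒has-fromℤ {p} Ip (divides q k≡q*p) =
      subst I (trans (fromℤ-* q (+ p)) (cong fromℤ (sym k≡q*p))) (has-* (fromℤ q) (ι p) Ip)

    has-fromℤ⇒∣ : ∀ {p k} → ¬ I 1ᴼ → Prime p → I (ι p) → I (fromℤ k) → + p ∣ k
    has-fromℤ⇒∣ {p} {k} proper p-prime Ip Ik with p ∣ℕ? ∣ k ∣
    ... | yes p∣k = ∣ᵤ⇒∣ p∣k
    ... | no p∤k = contradiction (has-1-of-coprime p-prime Ip (has-ι-∣∣ k Ik) p∤k) proper

  module _ {p} (p-prime : Prime p) {P Q : 𝒪 → Set} (P-prime : IsPrimeIdeal P) (Q-prime : IsPrimeIdeal Q)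
           (P∋p : P (ι p)) (Q∋p : Q (ι p)) where
    private
      module P = IsPrimeIdeal P-prime
      module Q = IsPrimeIdeal Q-prime
      module P-ideal = IsIdeal P.isIdeal
      module Q-ideal = IsIdeal Q.isIdeal

      P-fromℤ⇒∣ : ∀ {k} → P (fromℤ k) → + p ∣ k
      P-fromℤ⇒∣ = has-fromℤ⇒∣ P.isIdeal P.proper p-prime P∋p

      Q-fromℤ⇒∣ : ∀ {k} → Q (fromℤ k) → + p ∣ k
      Q-fromℤ⇒∣ = has-fromℤ⇒∣ Q.isIdeal Q.proper p-prime Q∋p

    -- If y ∈ P ∩ Q, the integer im(y)·x − im(x)·y lies in P ∩ ℤ = pℤ ⊆ Q for every x ∈ P,
    -- so im(y)·x ∈ Q; and im(y) ∉ Q, since otherwise p divides im(y), then re(y), then trace(y).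
    ⊆-of-∤trace : ∀ {y} → P y → Q y → ¬ (+ p ∣ trace y) → ∀ x → P x → Q x
    ⊆-of-∤trace {y} Py Qy p∤trace x Px =
      [ (λ Q∋im-y → contradiction (p∣trace Q∋im-y) p∤trace) , id ]′ (Q.prime _ x Q∋im-y·x)
      where
      P∋cross : P (fromℤ (cross y x))
      P∋cross = subst P (sym (cross-as-difference y x))
        (has-difference P.isIdeal (P-ideal.has-* (fromℤ (𝒪.im y)) x Px)
                                  (P-ideal.has-* (fromℤ (𝒪.im x)) y Py))

      Q∋im-y·x : Q (fromℤ (𝒪.im y) *ᴼ x)
      Q∋im-y·x = subst Q (sym (cross-decomposition y x))
        (Q-ideal.has-+ _ _ (Q-ideal.has-* (fromℤ (𝒪.im x)) y Qy)
                           (∣⇒has-fromℤ Q.isIdeal Q∋p (P-fromℤ⇒∣ P∋cross)))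

      p∣trace : Q (fromℤ (𝒪.im y)) → + p ∣ trace y
      p∣trace Q∋im-y = ∣m∣n⇒∣m+n (∣m∣n⇒∣m+n p∣re-y p∣re-y) (∣n⇒∣m*n t p∣im-y)
        where
        p∣im-y : + p ∣ 𝒪.im y
        p∣im-y = Q-fromℤ⇒∣ Q∋im-y

        p∣re-y : + p ∣ 𝒪.re y
        p∣re-y = P-fromℤ⇒∣ (subst P (sym (re-as-difference y))
          (has-difference P.isIdeal Py (P-ideal.has-* ω _ (∣⇒has-fromℤ P.isIdeal P∋p p∣im-y))))

  conj-⊆ : ∀ {p} → Prime p → ∀ {P Q} → IsPrimeIdeal P → IsPrimeIdeal Q → P (ι p) → Q (ι p) →
           ¬ (P ≐ Q) → ∀ y → Q y → P (conj y)
  conj-⊆ {p} p-prime {P} {Q} P-prime Q-prime P∋p Q∋p P≠Q y Qy =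
    [ conj-closed , id ]′ (IsPrimeIdeal.prime P-prime y (conj y) P∋y·ȳ)
    where
    P-ideal : IsIdeal P
    P-ideal = IsPrimeIdeal.isIdeal P-prime

    Q-ideal : IsIdeal Q
    Q-ideal = IsPrimeIdeal.isIdeal Q-prime

    Q∋norm : Q (fromℤ (norm y))
    Q∋norm = subst Q (trans (*ᴼ-comm (conj y) y) (*-conj-norm y))
                     (IsIdeal.has-* Q-ideal (conj y) y Qy)

    P∋y·ȳ : P (y *ᴼ conj y)
    P∋y·ȳ = subst P (sym (*-conj-norm y)) (∣⇒has-fromℤ P-ideal P∋p
      (has-fromℤ⇒∣ Q-ideal (IsPrimeIdeal.proper Q-prime) p-prime Q∋p Q∋norm))

    conj-closed : P y → P (conj y)
    conj-closed Py with + p ∣? trace y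
    ... | yes p∣trace =
      subst P (sym (conj-as-trace y)) (has-difference P-ideal (∣⇒has-fromℤ P-ideal P∋p p∣trace) Py)
    ... | no p∤trace = contradiction
      (λ x → ⊆-of-∤trace p-prime P-prime Q-prime P∋p Q∋p Py Qy p∤trace x
           , ⊆-of-∤trace p-prime Q-prime P-prime Q∋p P∋p Qy Py p∤trace x)
      P≠Q

  conjⱽ : ∀ {m} → Vec 𝒪 m → Vec 𝒪 m
  conjⱽ = map conj

  conjⱽ-+ⱽ : ∀ {m} (u w : Vec 𝒪 m) → conjⱽ (u +ⱽ w) ≡ conjⱽ u +ⱽ conjⱽ w
  conjⱽ-+ⱽ [] [] = refl
  conjⱽ-+ⱽ (a ∷ u) (b ∷ w) = cong₂ _∷_ (conj-+ a b) (conjⱽ-+ⱽ u w)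

  conjⱽ-·ⱽ : ∀ {m} a (u : Vec 𝒪 m) → conjⱽ (a ·ⱽ u) ≡ conj a ·ⱽ conjⱽ u
  conjⱽ-·ⱽ a u =
    trans (sym (map-∘ conj (a *ᴼ_) u)) (trans (map-cong (conj-* a) u) (map-∘ (conj a *ᴼ_) conj u))

  conjⱽ-involutive : ∀ {m} (u : Vec 𝒪 m) → conjⱽ (conjⱽ u) ≡ u
  conjⱽ-involutive u = trans (sym (map-∘ conj conj u)) (trans (map-cong conj-involutive u) (map-id u))

  conjⱽ-injective : ∀ {m} {u w : Vec 𝒪 m} → conjⱽ u ≡ conjⱽ w → u ≡ w
  conjⱽ-injective {u = u} {w} eq =
    trans (sym (conjⱽ-involutive u)) (trans (cong conjⱽ eq) (conjⱽ-involutive w))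

  hI-conjⱽ : ∀ {m} (u w : Vec 𝒪 m) → hI (conjⱽ u) (conjⱽ w) ≡ conj (hI u w)
  hI-conjⱽ [] [] = sym (conj-fromℤ (+ 0))
  hI-conjⱽ (a ∷ u) (b ∷ w) = begin
    conj a *ᴼ conj (conj b) +ᴼ hI (conjⱽ u) (conjⱽ w)
      ≡⟨ cong₂ _+ᴼ_ (sym (conj-* a (conj b))) (hI-conjⱽ u w) ⟩
    conj (a *ᴼ conj b) +ᴼ conj (hI u w)                ≡⟨ conj-+ (a *ᴼ conj b) (hI u w) ⟨
    conj (a *ᴼ conj b +ᴼ hI u w)                       ∎
    where open ≡-Reasoning

  +ⱽ-cancelʳ : ∀ {m} {u v w : Vec 𝒪 m} → u +ⱽ w ≡ v +ⱽ w → u ≡ v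
  +ⱽ-cancelʳ {u = []} {[]} {[]} _ = refl
  +ⱽ-cancelʳ {u = _ ∷ _} {_ ∷ _} {_ ∷ _} eq =
    cong₂ _∷_ (+ᴼ-cancelʳ (proj₁ (∷-injective eq))) (+ⱽ-cancelʳ (proj₂ (∷-injective eq)))

  conj-scaled : ∀ p r {A B} → ι p *ᴼ A ≡ ι r *ᴼ B → ι p *ᴼ conj A ≡ ι r *ᴼ conj B
  conj-scaled p r {A} {B} eq = begin
    ι p *ᴼ conj A        ≡⟨ cong (_*ᴼ conj A) (conj-fromℤ (+ p)) ⟨
    conj (ι p) *ᴼ conj A ≡⟨ conj-* (ι p) A ⟨
    conj (ι p *ᴼ A)      ≡⟨ cong conj eq ⟩
    conj (ι r *ᴼ B)      ≡⟨ conj-* (ι r) B ⟩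
    conj (ι r) *ᴼ conj B ≡⟨ cong (_*ᴼ conj B) (conj-fromℤ (+ r)) ⟩
    ι r *ᴼ conj B        ∎
    where open ≡-Reasoning

  conj-form-conj : ∀ x y → conj (conj x *ᴼ conj (conj y)) ≡ x *ᴼ conj y
  conj-form-conj x y =
    trans (conj-* (conj x) (conj (conj y))) (cong₂ _*ᴼ_ (conj-involutive x) (conj-involutive (conj y)))

  module _ {P Q : 𝒪 → Set} (P-ideal : IsIdeal P) (conj-Q⊆P : ∀ x → Q x → P (conj x)) where
    open IsIdeal P-ideal

    conj-Represented : ∀ p r m → Represented P p r m → Represented Q p r m
    conj-Represented p r m (f , f-+ , f-· , f-injective , f-h) = g , g-+ , g-· , g-injective , g-h
      where
      -- f may depend on the membership proof; additivity at x + 0 shows that it does not.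
      f-irrelevant : ∀ {x} (px px' : P x) → f x px ≡ f x px'
      f-irrelevant {x} px px' =
        +ⱽ-cancelʳ (trans (sym (f-+ x 0ᴼ px has-0 px+0)) (f-+ x 0ᴼ px' has-0 px+0))
        where
        px+0 : P (x +ᴼ 0ᴼ)
        px+0 = has-+ x 0ᴼ px has-0

      f-cong : ∀ {x y} → x ≡ y → (px : P x) (py : P y) → f x px ≡ f y py
      f-cong refl = f-irrelevant

      f̄ : (x : 𝒪) → Q x → Vec 𝒪 m
      f̄ x qx = f (conj x) (conj-Q⊆P x qx)

      g : (x : 𝒪) → Q x → Vec 𝒪 m
      g x qx = conjⱽ (f̄ x qx)

      g-+ : ∀ x y (qx : Q x) (qy : Q y) (qxy : Q (x +ᴼ y)) → g (x +ᴼ y) qxy ≡ g x qx +ⱽ g y qy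
      g-+ x y qx qy qxy = begin
        conjⱽ (f̄ (x +ᴼ y) qxy)        ≡⟨ cong conjⱽ (f-cong (conj-+ x y) _ px̄+ȳ) ⟩
        conjⱽ (f (conj x +ᴼ conj y) px̄+ȳ) ≡⟨ cong conjⱽ (f-+ _ _ (conj-Q⊆P x qx) (conj-Q⊆P y qy) px̄+ȳ) ⟩
        conjⱽ (f̄ x qx +ⱽ f̄ y qy)      ≡⟨ conjⱽ-+ⱽ (f̄ x qx) (f̄ y qy) ⟩
        g x qx +ⱽ g y qy              ∎
        where
        open ≡-Reasoning
        px̄+ȳ : P (conj x +ᴼ conj y)
        px̄+ȳ = has-+ _ _ (conj-Q⊆P x qx) (conj-Q⊆P y qy)

      g-· : ∀ a x (qx : Q x) (qax : Q (a *ᴼ x)) → g (a *ᴼ x) qax ≡ a ·ⱽ g x qx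
      g-· a x qx qax = begin
        conjⱽ (f̄ (a *ᴼ x) qax)           ≡⟨ cong conjⱽ (f-cong (conj-* a x) _ pāx̄) ⟩
        conjⱽ (f (conj a *ᴼ conj x) pāx̄) ≡⟨ cong conjⱽ (f-· (conj a) (conj x) (conj-Q⊆P x qx) pāx̄) ⟩
        conjⱽ (conj a ·ⱽ f̄ x qx)         ≡⟨ conjⱽ-·ⱽ (conj a) (f̄ x qx) ⟩
        conj (conj a) ·ⱽ g x qx          ≡⟨ cong (_·ⱽ g x qx) (conj-involutive a) ⟩
        a ·ⱽ g x qx                      ∎
        where
        open ≡-Reasoning
        pāx̄ : P (conj a *ᴼ conj x)
        pāx̄ = has-* (conj a) (conj x) (conj-Q⊆P x qx)

      g-injective : ∀ x y (qx : Q x) (qy : Q y) → g x qx ≡ g y qy → x ≡ y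
      g-injective x y qx qy eq = begin
        x             ≡⟨ conj-involutive x ⟨
        conj (conj x) ≡⟨ cong conj (f-injective _ _ (conj-Q⊆P x qx) (conj-Q⊆P y qy) (conjⱽ-injective eq)) ⟩
        conj (conj y) ≡⟨ conj-involutive y ⟩
        y             ∎
        where open ≡-Reasoning

      g-h : ∀ x y (qx : Q x) (qy : Q y) → ι p *ᴼ hI (g x qx) (g y qy) ≡ ι r *ᴼ (x *ᴼ conj y)
      g-h x y qx qy = begin
        ι p *ᴼ hI (g x qx) (g y qy)    ≡⟨ cong (ι p *ᴼ_) (hI-conjⱽ (f̄ x qx) (f̄ y qy)) ⟩
        ι p *ᴼ conj (hI (f̄ x qx) (f̄ y qy))
          ≡⟨ conj-scaled p r (f-h _ _ (conj-Q⊆P x qx) (conj-Q⊆P y qy)) ⟩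
        ι r *ᴼ conj (conj x *ᴼ conj (conj y)) ≡⟨ cong (ι r *ᴼ_) (conj-form-conj x y) ⟩
        ι r *ᴼ (x *ᴼ conj y)           ∎
        where open ≡-Reasoning

    conj-PosDefIntegral : ∀ p r → PosDefIntegral P p r → PosDefIntegral Q p r
    conj-PosDefIntegral p r (integral , positive) = integral' , positive'
      where
      integral' : ∀ x y → Q x → Q y → Σ 𝒪 λ z → ι p *ᴼ z ≡ ι r *ᴼ (x *ᴼ conj y)
      integral' x y qx qy with integral (conj x) (conj y) (conj-Q⊆P x qx) (conj-Q⊆P y qy)
      ... | z , eq = conj z , trans (conj-scaled p r eq) (cong (ι r *ᴼ_) (conj-form-conj x y))

      conj-≡0 : ∀ {x} → conj x ≡ 0ᴼ → x ≡ 0ᴼ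
      conj-≡0 {x} eq = trans (sym (conj-involutive x)) (trans (cong conj eq) (conj-fromℤ (+ 0)))

      positive' : ∀ x → Q x → ¬ (x ≡ 0ᴼ) → Σ ℕ λ k → (1 ≤ k) × (ι p *ᴼ ι k ≡ ι r *ᴼ (x *ᴼ conj x))
      positive' x qx x≢0 with positive (conj x) (conj-Q⊆P x qx) (x≢0 ∘ conj-≡0)
      ... | k , 1≤k , eq = k , 1≤k , trans (cong (ι p *ᴼ_) (sym (conj-fromℤ (+ k))))
                                       (trans (conj-scaled p r eq) (cong (ι r *ᴼ_) (conj-form-conj x x)))

    conj-InS : ∀ p r → InS P p r → InS Q p r
    conj-InS p r (pdi , m , 1≤m , rep) =
      conj-PosDefIntegral p r pdi , m , 1≤m , conj-Represented p r m rep

lemma2 : (d : ℕ) → 1 ≤ d → SquareFree d →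
    (p : ℕ) → Prime p → QF.Splits d p →
    (P₁ P₂ : 𝒪 → Set) →
    QF.IsPrimeIdeal d P₁ → QF.IsPrimeIdeal d P₂ →
    ¬ (QF._≐_ d P₁ P₂) →
    QF.LiesAbove d P₁ p → QF.LiesAbove d P₂ p →
    ((r : ℕ) → 1 ≤ r → (m : ℕ) → 1 ≤ m →
    QF.Represented d P₁ p r m ⇔ QF.Represented d P₂ p r m)
    ×
    ((r : ℕ) → 1 ≤ r → QF.InS d P₁ p r ⇔ QF.InS d P₂ p r)
lemma2 d _ _ p p-prime _ P₁ P₂ P₁-prime P₂-prime P₁≠P₂ P₁∋p P₂∋p =
    (λ r _ m _ → mk⇔ (conj-Represented P₁-ideal conj-P₂⊆P₁ p r m)
                     (conj-Represented P₂-ideal conj-P₁⊆P₂ p r m)) ,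
    (λ r _ → mk⇔ (conj-InS P₁-ideal conj-P₂⊆P₁ p r) (conj-InS P₂-ideal conj-P₁⊆P₂ p r))
  where
  open QF d using (IsIdeal; module IsPrimeIdeal; _≐_; conj)
  open Quadratic d

  P₁-ideal : IsIdeal P₁
  P₁-ideal = IsPrimeIdeal.isIdeal P₁-prime

  P₂-ideal : IsIdeal P₂
  P₂-ideal = IsPrimeIdeal.isIdeal P₂-prime

  P₂≠P₁ : ¬ (P₂ ≐ P₁)
  P₂≠P₁ P₂≐P₁ = P₁≠P₂ (λ x → swap (P₂≐P₁ x))

  conj-P₂⊆P₁ : ∀ x → P₂ x → P₁ (conj x)
  conj-P₂⊆P₁ = conj-⊆ p-prime P₁-prime P₂-prime P₁∋p P₂∋p P₁≠P₂

  conj-P₁⊆P₂ : ∀ x → P₁ x → P₂ (conj x)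
  conj-P₁⊆P₂ = conj-⊆ p-prime P₂-prime P₁-prime P₂∋p P₁∋p P₂≠P₁
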